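{- Let $f\colon\mathcal{X}\to\mathcal{S}$ and $g\colon\mathcal{S}'\to\mathcal{S}$ be functors of finite categories, let $\mathcal{X}'=\mathcal{X}\times_{\mathcal{S}}\mathcal{S}'$ with projections $f'\colon\mathcal{X}'\to\mathcal{S}'$, $g'\colon\mathcal{X}'\to\mathcal{X}$, and let $u\colon g^*f_*\to f'_*g'^*$ be the base change morphism. For $P\in\mathrm{Ob}(\mathcal{X})$ and $Q\in\mathrm{Ob}(\mathcal{S}')$, $u$ applied to the sheaf $k_{P*}\mathbb{Q}$ is injective at $Q$ if and only if every $PQ$-morphism has a $PQ$-factorization, and it is surjective at $Q$ if and only if any two $PQ$-factorizations of the same $PQ$-morphism are equivalent. Hence $u$ is an isomorphism if and only if for all $P,Q$ every $PQ$-morphism has a $PQ$-factorization and any two $PQ$-factorizations of a $PQ$-morphism are equivalent.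
   Context: $\mathbb{Q}(\mathcal{C})$ is the category of functors $\mathcal{C}^{\rm op}\to$ (finite-dimensional $\mathbb{Q}$-vector spaces). For a functor $h$, $h^*$ is precomposition and $h_*$ its right adjoint (right Kan extension). The fiber product is the strict one. The base change morphism $u$ is the morphism $g^*f_*\to f'_*g'^*$ adjoint to the composite $f_*\to f_*g'_*g'^*\cong g_*f'_*g'^*$, where the first arrow comes from the unit $\mathrm{id}\to g'_*g'^*$. $k_{P*}\mathbb{Q}$ is the presheaf $Y\mapsto\bigoplus_{\alpha\in\mathrm{Hom}(P,Y)}\mathbb{Q}$ with maps induced by composition. A $PQ$-morphism is a morphism $\varphi\colon f(P)\to g(Q)$ in $\mathcal{S}$. A $PQ$-factorization of $\varphi$ is a pair $(\nu,\mu)$ with $\nu$ a morphism of $\mathcal{X}$ with source $P$, $\mu$ a morphism of $\mathcal{S}'$ with target $Q$, $f(t\nu)=g(s\mu)$, and $\varphi=g(\mu)\circ f(\nu)$. Two $PQ$-factorizations $(\nu_1,\mu_1),(\nu_2,\mu_2)$ of $\varphi$ are primitively equivalent if there are $\nu_{12},\mu_{12}$ with $\nu_2=\nu_{12}\nu_1$, $\mu_1=\mu_2\mu_{12}$ and $f(\nu_{12})=g(\mu_{12})$; equivalence is the equivalence relation generated by primitive equivalence. -}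

module Defs where

open import Level using (0ℓ)
open import Data.Nat using (ℕ; zero; suc)
open import Data.Fin using (Fin)
import Data.Fin as Fin
open import Data.Product using (Σ; _×_; _,_; proj₁; proj₂)
open import Function.Bundles using (_↔_)
open import Relation.Binary.PropositionalEquality
  using (_≡_; refl; sym; cong; subst; subst₂)
open import Relation.Binary.Construct.Closure.Equivalence using (EqClosure)
open import Data.Rational using (ℚ; 0ℚ; 1ℚ; _+_; _*_; -_)
import Data.Rational.Properties as ℚP
open import Algebra.Bundles using (Ring)
open import Algebra.Module.Bundles using (LeftModule)
import Algebra.Construct.Pointwise as Pointwise

record Category : Set₁ where
  infixr 9 _∘_
  field
    Ob  : Set
    Hom : Ob → Ob → Set
    id  : ∀ {x} → Hom x x
    _∘_ : ∀ {x y z} → Hom y z → Hom x y → Hom x z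
    identityˡ : ∀ {x y} (h : Hom x y) → id ∘ h ≡ h
    identityʳ : ∀ {x y} (h : Hom x y) → h ∘ id ≡ h
    assoc : ∀ {w x y z} (h : Hom y z) (k : Hom x y) (l : Hom w x) →
            (h ∘ k) ∘ l ≡ h ∘ (k ∘ l)

open Category public using (Ob; Hom)

record IsFinite (C : Category) : Set where
  field
    nOb   : ℕ
    obFin : Ob C ↔ Fin nOb
    nHom  : Ob C → Ob C → ℕ
    homFin : ∀ x y → Hom C x y ↔ Fin (nHom x y)

record Functor (C D : Category) : Set where
  private
    module C = Category C
    module D = Category D
  field
    F₀ : C.Ob → D.Ob
    F₁ : ∀ {x y} → C.Hom x y → D.Hom (F₀ x) (F₀ y)
    F-id : ∀ {x} → F₁ (C.id {x}) ≡ D.id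
    F-∘  : ∀ {x y z} (h : C.Hom y z) (k : C.Hom x y) →
           F₁ (h C.∘ k) ≡ F₁ h D.∘ F₁ k

open Functor public using (F₀; F₁)

ℚring : Ring 0ℓ 0ℓ
ℚring = ℚP.+-*-ring

VecSpace : Set₁
VecSpace = LeftModule ℚring 0ℓ 0ℓ

vsum : (V : VecSpace) {n : ℕ} → (Fin n → LeftModule.Carrierᴹ V) → LeftModule.Carrierᴹ V
vsum V {zero}  v = LeftModule.0ᴹ V
vsum V {suc n} v = LeftModule._+ᴹ_ V (v Fin.zero) (vsum V (λ i → v (Fin.suc i)))

FinDim : VecSpace → Set
FinDim V = Σ ℕ λ n → Σ (Fin n → Carrierᴹ) λ e →
  ∀ v → Σ (Fin n → ℚ) λ c → v ≈ᴹ vsum V (λ i → c i *ₗ e i)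
  where open LeftModule V

record Presheaf (C : Category) : Set₁ where
  private module C = Category C
  field
    ob : C.Ob → VecSpace
  private
    El : C.Ob → Set
    El x = LeftModule.Carrierᴹ (ob x)
    _≈[_]_ : ∀ {x} → El x → (x' : C.Ob) → El x → Set
    _≈[_]_ {x} a _ b = LeftModule._≈ᴹ_ (ob x) a b
  field
    mor : ∀ {x y} → C.Hom x y → El y → El x
    mor-cong : ∀ {x y} (h : C.Hom x y) {a b : El y} →
              LeftModule._≈ᴹ_ (ob y) a b → mor h a ≈[ x ] mor h b
    mor-+ : ∀ {x y} (h : C.Hom x y) (a b : El y) →
           mor h (LeftModule._+ᴹ_ (ob y) a b) ≈[ x ] LeftModule._+ᴹ_ (ob x) (mor h a) (mor h b)
    mor-* : ∀ {x y} (h : C.Hom x y) (c : ℚ) (a : El y) →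
           mor h (LeftModule._*ₗ_ (ob y) c a) ≈[ x ] LeftModule._*ₗ_ (ob x) c (mor h a)
    F-id : ∀ {x} (a : El x) → mor (C.id {x}) a ≈[ x ] a
    F-∘  : ∀ {x y z} (h : C.Hom y z) (k : C.Hom x y) (a : El z) →
           mor (h C.∘ k) a ≈[ x ] mor k (mor h a)

FinDimPresheaf : {C : Category} → Presheaf C → Set
FinDimPresheaf {C} F = ∀ (x : Ob C) → FinDim (Presheaf.ob F x)

-- The presheaf k_{P*}ℚ : Y ↦ ⊕_{α ∈ Hom(P,Y)} ℚ  (= ℚ^{Hom(P,Y)}, Hom finite),
-- with h : Y → Z acting ℚ^{Hom(P,Z)} → ℚ^{Hom(P,Y)} through composition α ↦ h ∘ α.

funSpace : Set → VecSpace
funSpace A = record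
  { Carrierᴹ = A → ℚ
  ; _≈ᴹ_ = λ φ ψ → ∀ a → φ a ≡ ψ a
  ; _+ᴹ_ = λ φ ψ a → φ a + ψ a
  ; _*ₗ_ = λ c φ a → c * φ a
  ; 0ᴹ = λ _ → 0ℚ
  ; -ᴹ_ = λ φ a → - φ a
  ; isLeftModule = record
    { isLeftSemimodule = record
      { +ᴹ-isCommutativeMonoid = Pointwise.isCommutativeMonoid A ℚP.+-0-isCommutativeMonoid
      ; isPreleftSemimodule = record
        { *ₗ-cong = λ {c} {c'} {φ} {ψ} c≡c' φ≈ψ a → cong₂' c≡c' (φ≈ψ a)
        ; *ₗ-zeroˡ = λ φ a → ℚP.*-zeroˡ (φ a)
        ; *ₗ-distribʳ = λ φ c d a → ℚP.*-distribʳ-+ (φ a) c d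
        ; *ₗ-identityˡ = λ φ a → ℚP.*-identityˡ (φ a)
        ; *ₗ-assoc = λ c d φ a → ℚP.*-assoc c d (φ a)
        ; *ₗ-zeroʳ = λ c a → ℚP.*-zeroʳ c
        ; *ₗ-distribˡ = λ c φ ψ a → ℚP.*-distribˡ-+ c (φ a) (ψ a)
        }
      }
    ; -ᴹ‿cong = λ φ≈ψ a → cong -_ (φ≈ψ a)
    ; -ᴹ‿inverse = (λ φ a → ℚP.+-inverseˡ (φ a)) , (λ φ a → ℚP.+-inverseʳ (φ a))
    }
  }
  where
  cong₂' : ∀ {c c' x x' : ℚ} → c ≡ c' → x ≡ x' → c * x ≡ c' * x'
  cong₂' refl refl = refl

kP*ℚ : (X : Category) → Ob X → Presheaf X
kP*ℚ X P = record
  { ob = λ Y → funSpace (Category.Hom X P Y)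
  ; mor = λ h φ α → φ (h ∘ α)
  ; mor-cong = λ h φ≈ψ α → φ≈ψ (h ∘ α)
  ; mor-+ = λ h φ ψ α → refl
  ; mor-* = λ h c φ α → refl
  ; F-id = λ φ α → cong φ (identityˡ α)
  ; F-∘ = λ h k φ α → cong φ (assoc h k α)
  }
  where open Category X using (_∘_; identityˡ; assoc)

-- Strict fibre product X' = X ×_S S' (objects and morphisms), with
-- projections f' (second component) and g' (first component).

module FibreProduct {X S S' : Category} (f : Functor X S) (g : Functor S' S) where
  private
    module X = Category X
    module S = Category S
    module S' = Category S'

  record FPOb : Set where
    constructor fpob
    field
      x  : X.Ob
      s  : S'.Ob
      eq : F₀ f x ≡ F₀ g s
  open FPOb public

  record FPHom (a b : FPOb) : Set where
    constructor fphom
    field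
      ν : X.Hom (x a) (x b)
      μ : S'.Hom (s a) (s b)
      comm : subst₂ S.Hom (eq a) (eq b) (F₁ f ν) ≡ F₁ g μ
  open FPHom public

module BaseChange {X S S' : Category} (f : Functor X S) (g : Functor S' S)
                  (F : Presheaf X) (Q : Ob S') where
  private
    module X = Category X
    module S = Category S
    module S' = Category S'
    module F = Presheaf F
  open FibreProduct f g public

  El : X.Ob → Set
  El x = LeftModule.Carrierᴹ (F.ob x)

  _≈[_]_ : ∀ {x'} → El x' → (x : X.Ob) → El x' → Set
  _≈[_]_ {x'} a _ b = LeftModule._≈ᴹ_ (F.ob x') a b

  -- (g^* f_* F)(Q) = (f_* F)(g Q) = Hom(f^* h_{gQ}, F):
  -- families a_{x,α} ∈ F(x), α : f x → g Q, with F(ν)(a_{y,β}) = a_{x, β ∘ f ν}.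
  LHS : Set
  LHS = Σ ((x : X.Ob) → S.Hom (F₀ f x) (F₀ g Q) → El x) λ a →
        ∀ {x y} (ν : X.Hom x y) (β : S.Hom (F₀ f y) (F₀ g Q)) →
        F.mor ν (a y β) ≈[ x ] a x (β S.∘ F₁ f ν)

  -- (f'_* g'^* F)(Q) = Hom(f'^* h_Q, g'^* F):
  -- families b_{x',α'} ∈ F(g' x'), α' : f' x' → Q, compatible along morphisms of X'.
  RHS : Set
  RHS = Σ ((x' : FPOb) → S'.Hom (s x') Q → El (x x')) λ b →
        ∀ {x' y'} (m : FPHom x' y') (β : S'.Hom (s y') Q) →
        F.mor (ν m) (b y' β) ≈[ x x' ] b x' (β S'.∘ μ m)

  -- the base change morphism (component at Q):
  -- u(a)_{x',α'} = a_{g' x', g(α')}  (using f(g' x') = g(f' x'))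
  u : LHS → (x' : FPOb) → S'.Hom (s x') Q → El (x x')
  u (a , _) x' α' = a (x x') (subst (λ z → S.Hom z (F₀ g Q)) (sym (eq x')) (F₁ g α'))

  InjectiveAt : Set
  InjectiveAt = ∀ (a a' : LHS) →
    (∀ x' α' → u a x' α' ≈[ x x' ] u a' x' α') →
    ∀ x α → proj₁ a x α ≈[ x ] proj₁ a' x α

  SurjectiveAt : Set
  SurjectiveAt = ∀ (b : RHS) → Σ LHS λ a →
    ∀ x' α' → u a x' α' ≈[ x x' ] proj₁ b x' α'

BaseChangeIso : {X S S' : Category} (f : Functor X S) (g : Functor S' S) → Presheaf X → Set
BaseChangeIso {S' = S'} f g F = ∀ (Q : Ob S') →
  BaseChange.InjectiveAt f g F Q × BaseChange.SurjectiveAt f g F Q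

BaseChangeIsIso : {X S S' : Category} (f : Functor X S) (g : Functor S' S) → Set₁
BaseChangeIsIso {X} f g = ∀ (F : Presheaf X) → FinDimPresheaf F → BaseChangeIso f g F

module PQ {X S S' : Category} (f : Functor X S) (g : Functor S' S)
          (P : Ob X) (Q : Ob S') where
  private
    module X = Category X
    module S = Category S
    module S' = Category S'
  open FibreProduct f g

  PQMorphism : Set
  PQMorphism = S.Hom (F₀ f P) (F₀ g Q)

  record Factorization (φ : PQMorphism) : Set where
    constructor fact
    field
      tν : X.Ob
      sμ : S'.Ob
      obj-eq : F₀ f tν ≡ F₀ g sμ
      ν : X.Hom P tν
      μ : S'.Hom sμ Q
      factors : φ ≡ F₁ g μ S.∘ subst (S.Hom (F₀ f P)) obj-eq (F₁ f ν)
  open Factorization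

  PrimitivelyEquivalent : (φ : PQMorphism) → Factorization φ → Factorization φ → Set
  PrimitivelyEquivalent φ F1 F2 =
    Σ (X.Hom (tν F1) (tν F2)) λ ν₁₂ → Σ (S'.Hom (sμ F1) (sμ F2)) λ μ₁₂ →
      (ν F2 ≡ ν₁₂ X.∘ ν F1) × (μ F1 ≡ μ F2 S'.∘ μ₁₂) ×
      (subst₂ S.Hom (obj-eq F1) (obj-eq F2) (F₁ f ν₁₂) ≡ F₁ g μ₁₂)

  Equivalent : (φ : PQMorphism) → Factorization φ → Factorization φ → Set
  Equivalent φ = EqClosure (PrimitivelyEquivalent φ)

  EveryPQMorphismFactors : Set
  EveryPQMorphismFactors = ∀ (φ : PQMorphism) → Factorization φ

  FactorizationsEquivalent : Set
  FactorizationsEquivalent = ∀ (φ : PQMorphism) (F1 F2 : Factorization φ) → Equivalent φ F1 F2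

module Submission where

-- By the Yoneda lemma an element of (g^* f_* k_{P*}ℚ)(Q) is a function c on PQ-morphisms, an
-- element of (f'_* g'^* k_{P*}ℚ)(Q) is a function on PQ-factorizations (triples x′ ∈ X′,
-- μ : f′ x′ → Q, ν : P → g′ x′) that is constant along morphisms of X′, i.e. on equivalence
-- classes, and u sends c to c ∘ (composition of a factorization). So u is injective iff every
-- PQ-morphism is a composite, and surjective iff every class function factors through
-- composition, i.e. iff the factorizations of each PQ-morphism form a single class. The
-- separating test functions are indicators of "has a factorization" and of a class; finiteness
-- makes factorizations enumerable, so these are decidable and the indicators computable.
-- For an arbitrary presheaf the two conditions, now for all P, give a preimage of b by
-- evaluating b along any factorization of each morphism f y → g Q.

open import Defs

open import Algebra.Module.Bundles using (LeftModule)
open import Axiom.UniquenessOfIdentityProofs.WithK using (uip)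
open import Data.Bool using (if_then_else_)
open import Data.Fin using (Fin; zero; suc)
import Data.Fin.Properties as Fin
open import Data.List using (List; []; _∷_; map; concatMap; length; lookup)
open import Data.List.Membership.Propositional using (lose; find)
open import Data.List.Membership.Propositional.Properties using (∈-map⁺; ∈-concatMap⁺; ∈-allFin)
open import Data.List.Relation.Unary.Any using (here; index) renaming (any? to anyᴸ?)
open import Data.List.Relation.Unary.Any.Properties using (lookup-index)
open import Data.List.Relation.Unary.Enumerates.Setoid using (IsEnumeration)
import Data.List.Relation.Unary.Enumerates.Setoid.Properties as Enumeration
open import Data.Nat using (ℕ; zero; suc)
open import Data.Product using (Σ; ∃; _×_; _,_; proj₁; proj₂)
open import Data.Rational using (ℚ; 0ℚ; 1ℚ; _+_; _*_)
import Data.Rational.Properties as ℚ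
open import Algebra.Properties.Monoid.Sum ℚ.+-0-monoid using (sum; sum-cong-≗; sum-replicate-zero)
open import Data.Sum using (_⊎_; inj₁; inj₂; [_,_])
open import Data.Unit using (⊤; tt)
open import Function
  using (id; _∘_; const; case_of_; _↔_; _⇔_; mk⇔; mk↠ₛ; Inverse; Equivalence; StrictlySurjective)
open import Function.Properties.Inverse using (↔-sym; ↔⇒↠; ↔⇒↣)
open import Level using (0ℓ)
open import Relation.Binary using (Rel; Decidable; DecidableEquality)
open import Relation.Binary.Construct.Closure.Equivalence using (EqClosure; gfold)
open import Relation.Binary.Construct.Closure.ReflexiveTransitive as Star using (Star; ε; _◅_; _◅◅_)
open import Relation.Binary.Construct.Closure.Symmetric using (SymClosure; fwd; bwd)
open import Relation.Binary.PropositionalEquality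
  using (_≡_; refl; sym; trans; cong; cong₂; subst; subst₂; setoid; module ≡-Reasoning)
import Relation.Binary.Reasoning.Setoid as SetoidReasoning
open import Relation.Nullary using (Dec; yes; no; does; contradiction)
open import Relation.Nullary.Decidable using (map′; via-injection; _×-dec_; _⊎-dec_)

Enumerable : Set → Set
Enumerable A = ∃ (IsEnumeration (setoid A))

↔Fin⇒enumerable : ∀ {A : Set} {n} → A ↔ Fin n → Enumerable A
↔Fin⇒enumerable {A} {n} A↔Fin =
  _ , Enumeration.map⁺ (setoid (Fin n)) (setoid A) (↔⇒↠ (↔-sym A↔Fin)) ∈-allFin

image-enumerable : ∀ {A B : Set} (h : A → B) → StrictlySurjective _≡_ h → Enumerable A → Enumerable B
image-enumerable {A} {B} _ surjective (_ , complete) =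
  _ , Enumeration.map⁺ (setoid A) (setoid B) (mk↠ₛ surjective) complete

≡-enumerable : ∀ {A : Set} → DecidableEquality A → (a b : A) → Enumerable (a ≡ b)
≡-enumerable _≟_ a b with a ≟ b
... | yes a≡b = a≡b ∷ [] , λ a≡b′ → here (uip a≡b′ a≡b)
... | no a≢b  = [] , λ a≡b → contradiction a≡b a≢b

Σ-enumerable : ∀ {A : Set} {B : A → Set} → Enumerable A → (∀ a → Enumerable (B a)) → Enumerable (Σ A B)
Σ-enumerable {A} {B} (as , complete) Bs =
  concatMap pairs as , λ (a , b) → ∈-concatMap⁺ pairs (lose (complete a) (∈-map⁺ (a ,_) (proj₂ (Bs a) b)))
  where
  pairs : A → List (Σ A B)
  pairs a = map (a ,_) (proj₁ (Bs a))

∃? : ∀ {A : Set} {P : A → Set} → Enumerable A → (∀ a → Dec (P a)) → Dec (∃ P)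
∃? (as , complete) P? =
  map′ (λ any → let a , _ , pa = find any in a , pa) (λ (a , pa) → lose (complete a) pa) (anyᴸ? P? as)

inhabited? : ∀ {A : Set} → Enumerable A → Dec A
inhabited? (a ∷ _ , _)     = yes a
inhabited? ([] , complete) = no λ a → case complete a of λ ()

module VertexElimination {n : ℕ} (E : Rel (Fin (suc n)) 0ℓ) where

  Shortcut : Rel (Fin n) 0ℓ
  Shortcut i j = E (suc i) (suc j) ⊎ (E (suc i) zero × E zero (suc j))

  -- Star E with the vertex zero eliminated: every detour through zero becomes a Shortcut edge.
  Reach : Rel (Fin (suc n)) 0ℓ
  Reach zero    zero    = ⊤
  Reach zero    (suc j) = ∃ λ k → E zero (suc k) × Star Shortcut k j
  Reach (suc i) zero    = ∃ λ k → Star Shortcut i k × E (suc k) zero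
  Reach (suc i) (suc j) = Star Shortcut i j

  Star-Shortcut⇒Star : ∀ {i j} → Star Shortcut i j → Star E (suc i) (suc j)
  Star-Shortcut⇒Star ε                   = ε
  Star-Shortcut⇒Star (inj₁ e ◅ r)        = e ◅ Star-Shortcut⇒Star r
  Star-Shortcut⇒Star (inj₂ (e , e′) ◅ r) = e ◅ e′ ◅ Star-Shortcut⇒Star r

  Reach⇒Star : ∀ i j → Reach i j → Star E i j
  Reach⇒Star zero    zero    _           = ε
  Reach⇒Star zero    (suc j) (k , e , r) = e ◅ Star-Shortcut⇒Star r
  Reach⇒Star (suc i) zero    (k , r , e) = Star-Shortcut⇒Star r ◅◅ e ◅ ε
  Reach⇒Star (suc i) (suc j) r           = Star-Shortcut⇒Star r

  Reach-refl : ∀ i → Reach i i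
  Reach-refl zero    = tt
  Reach-refl (suc i) = ε

  E-Reach⇒Reach : ∀ {i k j} → E i k → Reach k j → Reach i j
  E-Reach⇒Reach {zero}  {zero}          e r            = r
  E-Reach⇒Reach {zero}  {suc k} {zero}  e r            = tt
  E-Reach⇒Reach {zero}  {suc k} {suc j} e r            = k , e , r
  E-Reach⇒Reach {suc i} {zero}  {zero}  e r            = i , ε , e
  E-Reach⇒Reach {suc i} {zero}  {suc j} e (l , e′ , r) = inj₂ (e , e′) ◅ r
  E-Reach⇒Reach {suc i} {suc k} {zero}  e (l , r , e′) = l , inj₁ e ◅ r , e′
  E-Reach⇒Reach {suc i} {suc k} {suc j} e r            = inj₁ e ◅ r

  Star⇒Reach : ∀ {i j} → Star E i j → Reach i j
  Star⇒Reach {i} ε   = Reach-refl i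
  Star⇒Reach (e ◅ r) = E-Reach⇒Reach e (Star⇒Reach r)

  Shortcut? : Decidable E → Decidable Shortcut
  Shortcut? E? i j = E? (suc i) (suc j) ⊎-dec (E? (suc i) zero ×-dec E? zero (suc j))

  Reach? : Decidable E → Decidable (Star Shortcut) → Decidable Reach
  Reach? E? Star-Shortcut? zero    zero    = yes tt
  Reach? E? Star-Shortcut? zero    (suc j) = Fin.any? λ k → E? zero (suc k) ×-dec Star-Shortcut? k j
  Reach? E? Star-Shortcut? (suc i) zero    = Fin.any? λ k → Star-Shortcut? i k ×-dec E? (suc k) zero
  Reach? E? Star-Shortcut? (suc i) (suc j) = Star-Shortcut? i j

Star-Fin? : ∀ {n} {E : Rel (Fin n) 0ℓ} → Decidable E → Decidable (Star E)
Star-Fin? {zero}      E? ()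
Star-Fin? {suc n} {E} E? i j =
  map′ (Reach⇒Star i j) Star⇒Reach (Reach? E? (Star-Fin? (Shortcut? E?)) i j)
  where open VertexElimination E

Star? : ∀ {A : Set} {R : Rel A 0ℓ} → Enumerable A → Decidable R → Decidable (Star R)
Star? {A} {R} (as , complete) R? a b =
  map′ (subst₂ (Star R) (sym (at-position a)) (sym (at-position b)) ∘ Star.gmap (lookup as) id)
       (Star.gmap position λ {a} {b} → subst₂ R (at-position a) (at-position b))
       (Star-Fin? (λ i j → R? (lookup as i) (lookup as j)) (position a) (position b))
  where
  position : A → Fin (length as)
  position a = index (complete a)
  at-position : ∀ a → a ≡ lookup as (position a)
  at-position a = lookup-index (complete a)

SymClosure? : ∀ {A : Set} {R : Rel A 0ℓ} → Decidable R → Decidable (SymClosure R)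
SymClosure? R? a b =
  map′ [ fwd , bwd ] (λ { (fwd r) → inj₁ r ; (bwd r) → inj₂ r }) (R? a b ⊎-dec R? b a)

EqClosure? : ∀ {A : Set} {R : Rel A 0ℓ} → Enumerable A → Decidable R → Decidable (EqClosure R)
EqClosure? enumerable R? = Star? enumerable (SymClosure? R?)

module _ {C : Category} (finC : IsFinite C) where
  open IsFinite finC

  Ob-enumerable : Enumerable (Ob C)
  Ob-enumerable = ↔Fin⇒enumerable obFin

  Hom-enumerable : ∀ a b → Enumerable (Hom C a b)
  Hom-enumerable a b = ↔Fin⇒enumerable (homFin a b)

  Ob-≟ : DecidableEquality (Ob C)
  Ob-≟ = via-injection (↔⇒↣ obFin) Fin._≟_

  Hom-≟ : ∀ {a b} → DecidableEquality (Hom C a b)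
  Hom-≟ {a} {b} = via-injection (↔⇒↣ (homFin a b)) Fin._≟_

module _ (C : Category) where
  private module C = Category C

  subst-dom-∘ : ∀ {a b c d} (e : a ≡ b) (h : Hom C b d) (k : Hom C c a) →
    subst (λ z → Hom C z d) (sym e) h C.∘ k ≡ h C.∘ subst (Hom C c) e k
  subst-dom-∘ refl h k = refl

  subst-cod-∘ : ∀ {a b c d} (e : a ≡ b) (h : Hom C c a) (k : Hom C d c) →
    subst (Hom C c) e h C.∘ k ≡ subst (Hom C d) e (h C.∘ k)
  subst-cod-∘ refl h k = refl

  subst-∘-subst₂ : ∀ {a a′ b b′ c} (e : a ≡ a′) (e′ : b ≡ b′) (h : Hom C a b) (k : Hom C c a) →
    subst (Hom C c) e′ (h C.∘ k) ≡ subst₂ (Hom C) e e′ h C.∘ subst (Hom C c) e k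
  subst-∘-subst₂ refl refl h k = refl

module Factorizations {X S S' : Category} (f : Functor X S) (g : Functor S' S) (Q : Ob S') where
  private
    module X = Category X
    module S = Category S
    module S' = Category S'
    module f = Functor f
    module g = Functor g
  open FibreProduct f g
  open PQ f g using (fact) public

  Factorization : (y : Ob X) → Hom S (F₀ f y) (F₀ g Q) → Set
  Factorization y = PQ.Factorization f g y Q

  node : ∀ {y α} → Factorization y α → FPOb
  node (fact t s e _ _ _) = fpob t s e

  -- g α′ as a morphism out of f (g′ x′): the form in which u evaluates its argument.
  ĝ : (x′ : FPOb) → Hom S' (s x′) Q → Hom S (F₀ f (x x′)) (F₀ g Q)
  ĝ x′ α′ = subst (λ z → Hom S z (F₀ g Q)) (sym (eq x′)) (F₁ g α′)

  composite : ∀ {y} (x′ : FPOb) → Hom S' (s x′) Q → Hom X y (x x′) → Hom S (F₀ f y) (F₀ g Q)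
  composite {y} x′ μ ν = F₁ g μ S.∘ subst (Hom S (F₀ f y)) (eq x′) (F₁ f ν)

  composite≡ĝ∘f : ∀ {y} (x′ : FPOb) μ (ν : Hom X y (x x′)) → composite x′ μ ν ≡ ĝ x′ μ S.∘ F₁ f ν
  composite≡ĝ∘f x′ μ ν = sym (subst-dom-∘ S (eq x′) (F₁ g μ) (F₁ f ν))

  composite-natural : ∀ {y x′ y′} (m : FPHom x′ y′) (β : Hom S' (s y′) Q) (α : Hom X y (x x′)) →
    composite y′ β (FPHom.ν m X.∘ α) ≡ composite x′ (β S'.∘ FPHom.μ m) α
  composite-natural {y} {x′} {y′} m β α = begin
      F₁ g β S.∘ subst (Hom S (F₀ f y)) (eq y′) (F₁ f (ν m X.∘ α))
        ≡⟨ cong (λ h → F₁ g β S.∘ subst (Hom S (F₀ f y)) (eq y′) h) (f.F-∘ (ν m) α) ⟩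
      F₁ g β S.∘ subst (Hom S (F₀ f y)) (eq y′) (F₁ f (ν m) S.∘ F₁ f α)
        ≡⟨ cong (F₁ g β S.∘_) (subst-∘-subst₂ S (eq x′) (eq y′) (F₁ f (ν m)) (F₁ f α)) ⟩
      F₁ g β S.∘ (subst₂ (Hom S) (eq x′) (eq y′) (F₁ f (ν m)) S.∘ fα)
        ≡⟨ cong (λ h → F₁ g β S.∘ (h S.∘ fα)) (comm m) ⟩
      F₁ g β S.∘ (F₁ g (μ m) S.∘ fα)
        ≡⟨ sym (S.assoc _ _ _) ⟩
      (F₁ g β S.∘ F₁ g (μ m)) S.∘ fα
        ≡⟨ cong (S._∘ fα) (sym (g.F-∘ β (μ m))) ⟩
      F₁ g (β S'.∘ μ m) S.∘ fα
        ∎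
    where
    open ≡-Reasoning
    open FPHom
    fα = subst (Hom S (F₀ f y)) (eq x′) (F₁ f α)

  unitFactorization : (x′ : FPOb) (α′ : Hom S' (s x′) Q) → Factorization (x x′) (ĝ x′ α′)
  unitFactorization x′ α′ = fact (x x′) (s x′) (eq x′) X.id α′ (begin
      ĝ x′ α′                ≡⟨ sym (S.identityʳ _) ⟩
      ĝ x′ α′ S.∘ S.id       ≡⟨ cong (ĝ x′ α′ S.∘_) (sym f.F-id) ⟩
      ĝ x′ α′ S.∘ F₁ f X.id  ≡⟨ sym (composite≡ĝ∘f x′ α′ X.id) ⟩
      composite x′ α′ X.id   ∎)
    where open ≡-Reasoning

  precompose : ∀ {y z β} → Factorization z β → (ν′ : Hom X y z) → Factorization y (β S.∘ F₁ f ν′)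
  precompose {y} {z} {β} (fact t s e ν μ p) ν′ = fact t s e (ν X.∘ ν′) μ (begin
      β S.∘ F₁ f ν′
        ≡⟨ cong (S._∘ F₁ f ν′) p ⟩
      (F₁ g μ S.∘ subst (Hom S (F₀ f z)) e (F₁ f ν)) S.∘ F₁ f ν′
        ≡⟨ S.assoc _ _ _ ⟩
      F₁ g μ S.∘ (subst (Hom S (F₀ f z)) e (F₁ f ν) S.∘ F₁ f ν′)
        ≡⟨ cong (F₁ g μ S.∘_) (subst-cod-∘ S e (F₁ f ν) (F₁ f ν′)) ⟩
      F₁ g μ S.∘ subst (Hom S (F₀ f y)) e (F₁ f ν S.∘ F₁ f ν′)
        ≡⟨ cong (λ h → F₁ g μ S.∘ subst (Hom S (F₀ f y)) e h) (sym (f.F-∘ ν ν′)) ⟩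
      F₁ g μ S.∘ subst (Hom S (F₀ f y)) e (F₁ f (ν X.∘ ν′))
        ∎)
    where open ≡-Reasoning

module BaseChangeAt {X S S' : Category} (f : Functor X S) (g : Functor S' S)
                    (F : Presheaf X) (Q : Ob S') where
  private
    module X = Category X
    module S = Category S
    module S' = Category S'
    module F = Presheaf F
    module Fact = PQ.Factorization
    module Fob (y : Ob X) = LeftModule (F.ob y)
    module ≈-Reasoning (y : Ob X) = SetoidReasoning (Fob.≈ᴹ-setoid y)
  open FibreProduct f g using (fpob; x; fphom)
  open BaseChange f g F Q using (El; _≈[_]_; LHS; RHS; u; InjectiveAt; SurjectiveAt)
  open Factorizations f g Q
  open PQ f g using (EveryPQMorphismFactors; FactorizationsEquivalent; PrimitivelyEquivalent; Equivalent)

  lhs-at-factorization : (a : LHS) → ∀ {y α} (Φ : Factorization y α) →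
    proj₁ a y α ≈[ y ] F.mor (Fact.ν Φ) (u a (node Φ) (Fact.μ Φ))
  lhs-at-factorization (a , natural) {y} {α} (fact t s e ν μ p) = begin
      a y α                      ≡⟨ cong (a y) (trans p (composite≡ĝ∘f x′ μ ν)) ⟩
      a y (ĝ x′ μ S.∘ F₁ f ν)    ≈⟨ Fob.≈ᴹ-sym y (natural ν (ĝ x′ μ)) ⟩
      F.mor ν (a t (ĝ x′ μ))     ∎
    where
    open ≈-Reasoning y
    x′ = fpob t s e

  u-injective-on-factorizations : (a a′ : LHS) → (∀ x′ α′ → u a x′ α′ ≈[ x x′ ] u a′ x′ α′) →
    ∀ {y α} → Factorization y α → proj₁ a y α ≈[ y ] proj₁ a′ y α
  u-injective-on-factorizations a a′ u-agrees {y} {α} Φ = begin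
      proj₁ a y α                                   ≈⟨ lhs-at-factorization a Φ ⟩
      F.mor (Fact.ν Φ) (u a (node Φ) (Fact.μ Φ))    ≈⟨ F.mor-cong (Fact.ν Φ) (u-agrees (node Φ) (Fact.μ Φ)) ⟩
      F.mor (Fact.ν Φ) (u a′ (node Φ) (Fact.μ Φ))   ≈⟨ Fob.≈ᴹ-sym y (lhs-at-factorization a′ Φ) ⟩
      proj₁ a′ y α                                  ∎
    where open ≈-Reasoning y

  module Extension (b : RHS) where

    valueAt : ∀ {y α} → Factorization y α → El y
    valueAt Φ = F.mor (Fact.ν Φ) (proj₁ b (node Φ) (Fact.μ Φ))

    valueAt-primitive : ∀ {y α} {Φ Ψ : Factorization y α} →
      PrimitivelyEquivalent y Q α Φ Ψ → valueAt Φ ≈[ y ] valueAt Ψ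
    valueAt-primitive {y} {Φ = fact t s e ν μ _} {fact t′ s′ e′ _ μ′ _} (ν₁₂ , μ₁₂ , refl , refl , commutes) =
      Fob.≈ᴹ-sym y (begin
        F.mor (ν₁₂ X.∘ ν) (proj₁ b (fpob t′ s′ e′) μ′)     ≈⟨ F.F-∘ ν₁₂ ν _ ⟩
        F.mor ν (F.mor ν₁₂ (proj₁ b (fpob t′ s′ e′) μ′))   ≈⟨ F.mor-cong ν (proj₂ b (fphom ν₁₂ μ₁₂ commutes) μ′) ⟩
        F.mor ν (proj₁ b (fpob t s e) (μ′ S'.∘ μ₁₂))       ∎)
      where open ≈-Reasoning y

    valueAt-equivalent : ∀ {y α} {Φ Ψ : Factorization y α} →
      Equivalent y Q α Φ Ψ → valueAt Φ ≈[ y ] valueAt Ψ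
    valueAt-equivalent {y} {α} =
      gfold (Fob.≈ᴹ-isEquivalence y) (valueAt {y} {α}) (λ {Φ} {Ψ} → valueAt-primitive {y} {α} {Φ} {Ψ})

    valueAt-precompose : ∀ {y z β} (Φ : Factorization z β) (ν′ : Hom X y z) →
      valueAt (precompose Φ ν′) ≈[ y ] F.mor ν′ (valueAt Φ)
    valueAt-precompose (fact _ _ _ ν _ _) ν′ = F.F-∘ ν ν′ _

    valueAt-unit : ∀ x′ α′ → valueAt (unitFactorization x′ α′) ≈[ x x′ ] proj₁ b x′ α′
    valueAt-unit x′ α′ = F.F-id _

  everyFactors⇒injective : (∀ y → EveryPQMorphismFactors y Q) → InjectiveAt
  everyFactors⇒injective factor a a′ u-agrees y α =
    u-injective-on-factorizations a a′ u-agrees (factor y α)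

  factorsUniquely⇒surjective :
    (∀ y → EveryPQMorphismFactors y Q × FactorizationsEquivalent y Q) → SurjectiveAt
  factorsUniquely⇒surjective factorsUniquely b = (extension , natural) , u-extension≈b
    where
    open Extension b
    factor : ∀ {y} α → Factorization y α
    factor {y} = proj₁ (factorsUniquely y)
    unique : ∀ {y α} (Φ Ψ : Factorization y α) → Equivalent y Q α Φ Ψ
    unique {y} {α} = proj₂ (factorsUniquely y) α
    extension : (y : Ob X) → Hom S (F₀ f y) (F₀ g Q) → El y
    extension y α = valueAt (factor α)
    natural : ∀ {y z} (ν′ : Hom X y z) β → F.mor ν′ (extension z β) ≈[ y ] extension y (β S.∘ F₁ f ν′)
    natural {y} ν′ β = begin
      F.mor ν′ (valueAt (factor β))        ≈⟨ Fob.≈ᴹ-sym y (valueAt-precompose (factor β) ν′) ⟩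
      valueAt (precompose (factor β) ν′)   ≈⟨ valueAt-equivalent (unique (precompose (factor β) ν′) (factor _)) ⟩
      valueAt (factor (β S.∘ F₁ f ν′))     ∎
      where open ≈-Reasoning y
    u-extension≈b : ∀ x′ α′ → u (extension , natural) x′ α′ ≈[ x x′ ] proj₁ b x′ α′
    u-extension≈b x′ α′ = begin
      valueAt (factor (ĝ x′ α′))           ≈⟨ valueAt-equivalent (unique (factor _) (unitFactorization x′ α′)) ⟩
      valueAt (unitFactorization x′ α′)    ≈⟨ valueAt-unit x′ α′ ⟩
      proj₁ b x′ α′                        ∎
      where open ≈-Reasoning (x x′)

-- Defined through does (not by matching on yes/no) so that it computes on suc i Fin.≟ suc k.
indicator : ∀ {A : Set} → Dec A → ℚ
indicator a? = if does a? then 1ℚ else 0ℚ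

indicator-yes : ∀ {A : Set} (a? : Dec A) → A → indicator a? ≡ 1ℚ
indicator-yes (yes _) _ = refl
indicator-yes (no ¬a) a = contradiction a ¬a

indicator≡1⇒ : ∀ {A : Set} (a? : Dec A) → indicator a? ≡ 1ℚ → A
indicator≡1⇒ (yes a) _ = a
indicator≡1⇒ (no _)  ()

indicator-cong : ∀ {A B : Set} (a? : Dec A) (b? : Dec B) → A ⇔ B → indicator a? ≡ indicator b?
indicator-cong (yes _) (yes _) _   = refl
indicator-cong (yes a) (no ¬b) A⇔B = contradiction (Equivalence.to A⇔B a) ¬b
indicator-cong (no ¬a) (yes b) A⇔B = contradiction (Equivalence.from A⇔B b) ¬a
indicator-cong (no _)  (no _)  _   = refl

sum-indicator : ∀ {n} (w : Fin n → ℚ) (k : Fin n) → sum {n} (λ i → w i * indicator (i Fin.≟ k)) ≡ w k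
sum-indicator {suc n} w zero = begin
    w zero * 1ℚ + sum {n} (λ i → w (suc i) * 0ℚ)
      ≡⟨ cong₂ _+_ (ℚ.*-identityʳ (w zero)) (sum-cong-≗ {n} (λ i → ℚ.*-zeroʳ (w (suc i)))) ⟩
    w zero + sum {n} (λ _ → 0ℚ)   ≡⟨ cong (w zero +_) (sum-replicate-zero n) ⟩
    w zero + 0ℚ                   ≡⟨ ℚ.+-identityʳ (w zero) ⟩
    w zero                        ∎
  where open ≡-Reasoning
sum-indicator {suc n} w (suc k) = begin
    w zero * 0ℚ + sum {n} (λ i → w (suc i) * indicator (i Fin.≟ k))
      ≡⟨ cong₂ _+_ (ℚ.*-zeroʳ (w zero)) (sum-indicator (w ∘ suc) k) ⟩
    0ℚ + w (suc k)                ≡⟨ ℚ.+-identityˡ (w (suc k)) ⟩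
    w (suc k)                     ∎
  where open ≡-Reasoning

vsum-pointwise : ∀ {A : Set} {n} (v : Fin n → A → ℚ) (a : A) → vsum (funSpace A) v a ≡ sum {n} (λ i → v i a)
vsum-pointwise {n = zero}  v a = refl
vsum-pointwise {n = suc n} v a = cong (v zero a +_) (vsum-pointwise (v ∘ suc) a)

funSpace-finDim : ∀ {A : Set} {n} → A ↔ Fin n → FinDim (funSpace A)
funSpace-finDim {A} {n} A↔Fin = n , basis , λ v → v ∘ from , λ a → sym (begin
    vsum (funSpace A) (λ i a′ → v (from i) * basis i a′) a
      ≡⟨ vsum-pointwise (λ i a′ → v (from i) * basis i a′) a ⟩
    sum {n} (λ i → v (from i) * indicator (i Fin.≟ to a))   ≡⟨ sum-indicator (v ∘ from) (to a) ⟩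
    v (from (to a))                                          ≡⟨ cong v (strictlyInverseʳ a) ⟩
    v a                                                      ∎)
  where
  open Inverse A↔Fin
  open ≡-Reasoning
  basis : Fin n → A → ℚ
  basis i a = indicator (i Fin.≟ to a)

kP*ℚ-finDim : ∀ {X} → IsFinite X → (P : Ob X) → FinDimPresheaf (kP*ℚ X P)
kP*ℚ-finDim finX P Y = funSpace-finDim (IsFinite.homFin finX P Y)

module BaseChangeAtkP*ℚ {X S S' : Category} (finX : IsFinite X) (finS : IsFinite S) (finS' : IsFinite S')
                        (f : Functor X S) (g : Functor S' S) (P : Ob X) (Q : Ob S') where
  private
    module X = Category X
    module S = Category S
    module S' = Category S'
    module f = Functor f
    module Fact = PQ.Factorization
  open FibreProduct f g using (FPOb; x; s; eq; FPHom)
  open BaseChange f g (kP*ℚ X P) Q using (LHS; RHS; u; InjectiveAt; SurjectiveAt)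
  open BaseChangeAt f g (kP*ℚ X P) Q using (lhs-at-factorization; u-injective-on-factorizations; module Extension)
  open Factorizations f g Q using (node; ĝ; composite; composite-natural; unitFactorization; precompose)
  open PQ f g P Q

  factorizations : ∀ φ → Enumerable (Factorization φ)
  factorizations φ = image-enumerable (λ (t , s , e , ν , μ , p) → fact t s e ν μ p)
    (λ (fact t s e ν μ p) → (t , s , e , ν , μ , p) , refl)
    (Σ-enumerable (Ob-enumerable finX) λ t → Σ-enumerable (Ob-enumerable finS') λ s →
     Σ-enumerable (≡-enumerable (Ob-≟ finS) (F₀ f t) (F₀ g s)) λ _ →
     Σ-enumerable (Hom-enumerable finX P t) λ _ → Σ-enumerable (Hom-enumerable finS' s Q) λ _ →
     ≡-enumerable (Hom-≟ finS) φ _)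

  factorization? : ∀ φ → Dec (Factorization φ)
  factorization? φ = inhabited? (factorizations φ)

  primitivelyEquivalent? : ∀ φ → Decidable (PrimitivelyEquivalent φ)
  primitivelyEquivalent? φ (fact t s _ ν μ _) (fact t′ s′ _ ν′ μ′ _) =
    ∃? (Hom-enumerable finX t t′) λ ν₁₂ → ∃? (Hom-enumerable finS' s s′) λ μ₁₂ →
      Hom-≟ finX ν′ (ν₁₂ X.∘ ν) ×-dec Hom-≟ finS' μ (μ′ S'.∘ μ₁₂) ×-dec Hom-≟ finS _ _

  equivalent? : ∀ φ → Decidable (Equivalent φ)
  equivalent? φ = EqClosure? (factorizations φ) (primitivelyEquivalent? φ)

  yoneda : (PQMorphism → ℚ) → LHS
  yoneda c = (λ y β γ → c (β S.∘ F₁ f γ)) , λ ν β α → cong c (begin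
      β S.∘ F₁ f (ν X.∘ α)         ≡⟨ cong (β S.∘_) (f.F-∘ ν α) ⟩
      β S.∘ (F₁ f ν S.∘ F₁ f α)    ≡⟨ sym (S.assoc β (F₁ f ν) (F₁ f α)) ⟩
      (β S.∘ F₁ f ν) S.∘ F₁ f α    ∎)
    where open ≡-Reasoning

  lhs-at-identity : (a : LHS) → ∀ {y} α (γ : Hom X P y) → proj₁ a y α γ ≡ proj₁ a P (α S.∘ F₁ f γ) X.id
  lhs-at-identity (a , natural) α γ = trans (cong (a _ α) (sym (X.identityʳ γ))) (natural γ α X.id)

  module EquivalenceClass {φ : PQMorphism} (Φ₁ : Factorization φ) where

    InClass : (x′ : FPOb) → Hom S' (s x′) Q → Hom X P (x x′) → Set
    InClass x′ μ ν = Σ (φ ≡ composite x′ μ ν) λ p → Equivalent φ Φ₁ (fact (x x′) (s x′) (eq x′) ν μ p)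

    inClass? : ∀ x′ μ ν → Dec (InClass x′ μ ν)
    inClass? x′ μ ν = ∃? (≡-enumerable (Hom-≟ finS) φ _) λ _ → equivalent? φ Φ₁ _

    inClass?-at : (Φ : Factorization φ) → Dec (InClass (node Φ) (Fact.μ Φ) (Fact.ν Φ))
    inClass?-at Φ = inClass? (node Φ) (Fact.μ Φ) (Fact.ν Φ)

    inClass-self : InClass (node Φ₁) (Fact.μ Φ₁) (Fact.ν Φ₁)
    inClass-self = Fact.factors Φ₁ , ε

    inClass⇒equivalent : (Φ : Factorization φ) → InClass (node Φ) (Fact.μ Φ) (Fact.ν Φ) → Equivalent φ Φ₁ Φ
    inClass⇒equivalent Φ (p , Φ₁~) = subst (λ q → Equivalent φ Φ₁ (fact _ _ _ _ _ q)) (uip p (Fact.factors Φ)) Φ₁~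

    FPHom⇒primitivelyEquivalent : ∀ {x′ y′} (m : FPHom x′ y′) β α p q →
      PrimitivelyEquivalent φ (fact (x x′) (s x′) (eq x′) α (β S'.∘ FPHom.μ m) p)
                              (fact (x y′) (s y′) (eq y′) (FPHom.ν m X.∘ α) β q)
    FPHom⇒primitivelyEquivalent m _ _ _ _ = FPHom.ν m , FPHom.μ m , refl , refl , FPHom.comm m

    classIndicator : RHS
    classIndicator = (λ x′ μ ν → indicator (inClass? x′ μ ν)) , λ {x′} {y′} m β α →
      indicator-cong (inClass? y′ β (FPHom.ν m X.∘ α)) (inClass? x′ (β S'.∘ FPHom.μ m) α) (mk⇔
        (λ (p , Φ₁~) → let p′ = trans p (composite-natural m β α)
                       in p′ , Φ₁~ ◅◅ bwd (FPHom⇒primitivelyEquivalent m β α p′ p) ◅ ε)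
        (λ (p , Φ₁~) → let p′ = trans p (sym (composite-natural m β α))
                       in p′ , Φ₁~ ◅◅ fwd (FPHom⇒primitivelyEquivalent m β α p p′) ◅ ε))

  injective⇒factors : InjectiveAt → EveryPQMorphismFactors
  injective⇒factors injective φ = subst Factorization (trans (cong (φ S.∘_) f.F-id) (S.identityʳ φ))
      (indicator≡1⇒ (factorization? _) (injective (yoneda factorizable) (yoneda (const 1ℚ)) u-agrees P φ X.id))
    where
    factorizable : PQMorphism → ℚ
    factorizable ψ = indicator (factorization? ψ)
    -- u cannot tell factorizable from the constant 1: its argument is always a composite.
    u-agrees : ∀ x′ α′ (γ : Hom X P (x x′)) → factorizable (ĝ x′ α′ S.∘ F₁ f γ) ≡ 1ℚ
    u-agrees x′ α′ γ = indicator-yes (factorization? _) (precompose (unitFactorization x′ α′) γ)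

  factors⇒injective : EveryPQMorphismFactors → InjectiveAt
  factors⇒injective factor a a′ u-agrees y α γ = begin
      proj₁ a y α γ                    ≡⟨ lhs-at-identity a α γ ⟩
      proj₁ a P (α S.∘ F₁ f γ) X.id    ≡⟨ u-injective-on-factorizations a a′ u-agrees (factor _) X.id ⟩
      proj₁ a′ P (α S.∘ F₁ f γ) X.id   ≡⟨ sym (lhs-at-identity a′ α γ) ⟩
      proj₁ a′ y α γ                   ∎
    where open ≡-Reasoning

  -- The preimage under u of the indicator of the class of Φ₁ takes one value, a P φ id, at every
  -- factorization of φ; since that value is 1 at Φ₁, every factorization is in the class.
  surjective⇒equivalent : SurjectiveAt → FactorizationsEquivalent
  surjective⇒equivalent surjective φ Φ₁ Φ₂ = inClass⇒equivalent Φ₂ (indicator≡1⇒ (inClass?-at Φ₂) (begin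
      indicator (inClass?-at Φ₂)   ≡⟨ indicator-at Φ₂ ⟩
      proj₁ a P φ X.id             ≡⟨ sym (indicator-at Φ₁) ⟩
      indicator (inClass?-at Φ₁)   ≡⟨ indicator-yes (inClass?-at Φ₁) inClass-self ⟩
      1ℚ                           ∎))
    where
    open EquivalenceClass Φ₁
    open ≡-Reasoning
    a : LHS
    a = proj₁ (surjective classIndicator)
    indicator-at : (Φ : Factorization φ) → indicator (inClass?-at Φ) ≡ proj₁ a P φ X.id
    indicator-at Φ = begin
      indicator (inClass?-at Φ)
        ≡⟨ sym (proj₂ (surjective classIndicator) (node Φ) (Fact.μ Φ) (Fact.ν Φ)) ⟩
      u a (node Φ) (Fact.μ Φ) (Fact.ν Φ)             ≡⟨ cong (u a (node Φ) (Fact.μ Φ)) (sym (X.identityʳ _)) ⟩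
      u a (node Φ) (Fact.μ Φ) (Fact.ν Φ X.∘ X.id)    ≡⟨ sym (lhs-at-factorization a Φ X.id) ⟩
      proj₁ a P φ X.id                               ∎

  equivalent⇒surjective : FactorizationsEquivalent → SurjectiveAt
  equivalent⇒surjective unique b = yoneda extension , u-extension≈b
    where
    open Extension b
    extension : PQMorphism → ℚ
    extension ψ with factorization? ψ
    ... | yes Ψ = valueAt Ψ X.id
    ... | no _  = 0ℚ
    extension-at : ∀ {ψ} (Ψ : Factorization ψ) → extension ψ ≡ valueAt Ψ X.id
    extension-at {ψ} Ψ with factorization? ψ
    ... | yes Ψ′ = valueAt-equivalent (unique ψ Ψ′ Ψ) X.id
    ... | no ¬Ψ  = contradiction Ψ ¬Ψ
    u-extension≈b : ∀ x′ α′ (γ : Hom X P (x x′)) → extension (ĝ x′ α′ S.∘ F₁ f γ) ≡ proj₁ b x′ α′ γ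
    u-extension≈b x′ α′ γ = begin
      extension (ĝ x′ α′ S.∘ F₁ f γ)                          ≡⟨ extension-at (precompose (unitFactorization x′ α′) γ) ⟩
      valueAt (precompose (unitFactorization x′ α′) γ) X.id   ≡⟨ valueAt-precompose (unitFactorization x′ α′) γ X.id ⟩
      valueAt (unitFactorization x′ α′) (γ X.∘ X.id)          ≡⟨ valueAt-unit x′ α′ (γ X.∘ X.id) ⟩
      proj₁ b x′ α′ (γ X.∘ X.id)                              ≡⟨ cong (proj₁ b x′ α′) (X.identityʳ γ) ⟩
      proj₁ b x′ α′ γ                                         ∎
      where open ≡-Reasoning

mainTheorem14 : (X S S' : Category) → IsFinite X → IsFinite S → IsFinite S' →
    (f : Functor X S) (g : Functor S' S) →
    (∀ (P : Ob X) (Q : Ob S') →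
      (BaseChange.InjectiveAt f g (kP*ℚ X P) Q ⇔ PQ.EveryPQMorphismFactors f g P Q)
      × (BaseChange.SurjectiveAt f g (kP*ℚ X P) Q ⇔ PQ.FactorizationsEquivalent f g P Q))
    × (BaseChangeIsIso f g ⇔
        (∀ (P : Ob X) (Q : Ob S') →
          PQ.EveryPQMorphismFactors f g P Q × PQ.FactorizationsEquivalent f g P Q))
mainTheorem14 X S S' finX finS finS' f g =
  (λ P Q → let open BaseChangeAtkP*ℚ finX finS finS' f g P Q in
    mk⇔ injective⇒factors factors⇒injective , mk⇔ surjective⇒equivalent equivalent⇒surjective) ,
  mk⇔ iso⇒factorsUniquely factorsUniquely⇒iso
  where
  FactorsUniquely : Set
  FactorsUniquely = ∀ P Q → PQ.EveryPQMorphismFactors f g P Q × PQ.FactorizationsEquivalent f g P Q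

  iso⇒factorsUniquely : BaseChangeIsIso f g → FactorsUniquely
  iso⇒factorsUniquely iso P Q =
    let open BaseChangeAtkP*ℚ finX finS finS' f g P Q
        injective , surjective = iso (kP*ℚ X P) (kP*ℚ-finDim finX P) Q
    in injective⇒factors injective , surjective⇒equivalent surjective

  -- Sufficiency holds for every presheaf, finite-dimensional or not.
  factorsUniquely⇒iso : FactorsUniquely → BaseChangeIsIso f g
  factorsUniquely⇒iso factorsUniquely F _ Q =
    let open BaseChangeAt f g F Q
    in everyFactors⇒injective (λ y → proj₁ (factorsUniquely y Q)) , factorsUniquely⇒surjective (λ y → factorsUniquely y Q)
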